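{- Let $n$ and $m$ be positive integers with $m < n$. Let $Q$ denote the GHZ query distribution, i.e. the uniform distribution on $\mathcal{Q} = \{x \in \mathbb{F}_2^3 : x_1+x_2+x_3 = 0\}$, and let $Q^n$ be the distribution on $\mathbb{F}_2^{3\times n}$ whose $n$ columns are independent samples of $Q$. Let $\mathcal{V} \le \mathbb{F}_2^{1\times n}$ be a linear subspace of codimension $m$, and let $\mathcal{W} \subseteq \mathbb{F}_2^{3\times n}$ be an affine shift of $\mathcal{V}^3$ with $Q^n(\mathcal{W}) > 0$. Then there exist at least $n - m$ distinct values of $j \in [n]$ for which $Q$ is locally embeddable in the $j$-th coordinate of $\tilde{P} = Q^n \mid \mathcal{W}$.
   Context: $\mathcal{V}^3$ is the set of $3\times n$ matrices all of whose rows lie in $\mathcal{V}$. Local embeddability: let $\Sigma$ be a finite set, $k,n$ positive integers, $Q$ a distribution on $\Sigma^k$ and $\tilde P$ a distribution on $\Sigma^{k\times n}$. $Q$ is locally embeddable in the $j$-th coordinate of $\tilde P$ if there exist a probability distribution $R$ on a (finite) set $\mathcal{R}$ and functions $e_1,\dots,e_k : \Sigma\times\mathcal{R} \to \Sigma^n$ such that, sampling $q \gets Q$ and $r \gets R$ independently and letting $\tilde X$ be the $k\times n$ matrix whose $i$-th row is $e_i(q_i, r)$, (1) the law of $\tilde X$ is exactly $\tilde P$, and (2) with probability $1$ the $j$-th column $\tilde X^j$ equals $q$. Here $\Sigma = \mathbb{F}_2$ and $k=3$. -}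

module Defs where

open import Data.Bool using (Bool; true; false; _xor_; if_then_else_; _∧_)
open import Data.Nat using (ℕ; zero; suc)
open import Data.Fin using (Fin)
open import Data.List using (List; []; _∷_; concatMap; map; allFin)
open import Data.Bool.ListAction using (any; all)
open import Data.Vec using (Vec; []; _∷_; lookup; tabulate; zipWith; replicate; foldr)
import Data.Vec.Properties as VecP
open import Data.Bool.Properties using () renaming (_≟_ to _≟B_)
open import Data.Rational using (ℚ; 0ℚ; 1ℚ; _+_; _*_; _÷_; _≤_; _<_; _/_; >-nonZero)
open import Data.Integer using (+_)
open import Data.Product using (Σ; _×_; _,_)
open import Relation.Binary.PropositionalEquality using (_≡_)
open import Relation.Nullary.Decidable using (⌊_⌋)

-- F₂ = Bool (false = 0, true = 1, addition = xor)
-- Row vectors in F₂^{1×n} : Vec Bool n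
-- Matrices in F₂^{k×n}     : Vec (Vec Bool n) k   (list of k rows)

Mat : ℕ → ℕ → Set
Mat k n = Vec (Vec Bool n) k

_⊕_ : ∀ {n} → Vec Bool n → Vec Bool n → Vec Bool n
_⊕_ = zipWith _xor_

𝟎 : ∀ {n} → Vec Bool n
𝟎 = replicate _ false

column : ∀ {k n} → Fin n → Mat k n → Vec Bool k
column j X = Data.Vec.map (λ row → lookup row j) X

_≟M_ : ∀ {k n} (X Y : Mat k n) → _
_≟M_ = VecP.≡-dec (VecP.≡-dec _≟B_)

allVecOf : ∀ {A : Set} → List A → (k : ℕ) → List (Vec A k)
allVecOf xs zero    = [] ∷ []
allVecOf xs (suc k) = concatMap (λ v → map (λ x → x ∷ v) xs) (allVecOf xs k)

allVec : (n : ℕ) → List (Vec Bool n)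
allVec = allVecOf (false ∷ true ∷ [])

allMat : (k n : ℕ) → List (Mat k n)
allMat k n = allVecOf (allVec n) k

sumL : ∀ {A : Set} → List A → (A → ℚ) → ℚ
sumL []       f = 0ℚ
sumL (x ∷ xs) f = f x + sumL xs f

sumFin : (r : ℕ) → (Fin r → ℚ) → ℚ
sumFin r f = sumL (allFin r) f

prodFin : (n : ℕ) → (Fin n → ℚ) → ℚ
prodFin n f = Data.List.foldr (λ j acc → f j * acc) 1ℚ (allFin n)

indicator : Bool → ℚ
indicator true  = 1ℚ
indicator false = 0ℚ

lincomb : ∀ {d n} → Vec Bool d → Vec (Vec Bool n) d → Vec Bool n
lincomb c b = foldr _ _⊕_ 𝟎 (zipWith (λ ci bi → if ci then bi else 𝟎) c b)

LinIndep : ∀ {d n} → Vec (Vec Bool n) d → Set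
LinIndep {d} b = ∀ (c : Vec Bool d) → lincomb c b ≡ 𝟎 → c ≡ 𝟎

inSpan : ∀ {d n} → Vec (Vec Bool n) d → Vec Bool n → Bool
inSpan {d} b v = any (λ c → ⌊ VecP.≡-dec _≟B_ (lincomb c b) v ⌋) (allVec d)

-- membership in the affine shift W = A + V³ of V³ (V = span b):
-- M ∈ W  iff  M - A ∈ V³  iff every row of M - A (= M + A over F₂) lies in V
inAffine : ∀ {d n} → Vec (Vec Bool n) d → Mat 3 n → Mat 3 n → Bool
inAffine b A M = all (λ i → inSpan b (lookup M i ⊕ lookup A i)) (allFin 3)

GHZ : Vec Bool 3 → ℚ
GHZ (x₁ ∷ x₂ ∷ x₃ ∷ []) = if (x₁ xor x₂ xor x₃) then 0ℚ else (+ 1 / 4)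

Qpow : (n : ℕ) → Mat 3 n → ℚ
Qpow n M = prodFin n (λ j → GHZ (column j M))

QpowW : ∀ {d} (n : ℕ) → Vec (Vec Bool n) d → Mat 3 n → ℚ
QpowW n b A = sumL (allMat 3 n) (λ M → Qpow n M * indicator (inAffine b A M))

Qcond : ∀ {d} (n : ℕ) (b : Vec (Vec Bool n) d) (A : Mat 3 n) →
        0ℚ < QpowW n b A → Mat 3 n → ℚ
Qcond n b A pos M =
  (Qpow n M * indicator (inAffine b A M) ÷ QpowW n b A) {{>-nonZero pos}}

embMat : ∀ {k n r} → (Fin k → Bool → Fin r → Vec Bool n) →
         Vec Bool k → Fin r → Mat k n
embMat e q ρ = tabulate (λ i → e i (lookup q i) ρ)

LocallyEmbeddable : ∀ {k n} → (Vec Bool k → ℚ) → (Mat k n → ℚ) → Fin n → Set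
LocallyEmbeddable {k} {n} Q P j =
  Σ ℕ λ r →                                   -- finite set ℛ = Fin r
  Σ (Fin r → ℚ) λ R →
  (∀ ρ → 0ℚ ≤ R ρ) × (sumFin r R ≡ 1ℚ) ×
  Σ (Fin k → Bool → Fin r → Vec Bool n) λ e →  -- e₁,…,e_k : Σ × ℛ → Σⁿ
    -- (1) the law of X̃ is exactly P
    (∀ (M : Mat k n) →
       sumL (allVec k) (λ q → sumFin r (λ ρ →
         Q q * R ρ * indicator ⌊ embMat e q ρ ≟M M ⌋)) ≡ P M)
    -- (2) with probability 1 the j-th column of X̃ equals q
  × (∀ (q : Vec Bool k) (ρ : Fin r) → 0ℚ < Q q * R ρ →
       column j (embMat e q ρ) ≡ q)

module Submission where

-- Let V = span b (dimension d = n - m), P̃ = Qⁿ | W, and let S be the support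
-- of V, i.e. the coordinates j on which some vector of V is nonzero.
--
-- * Counting. c ↦ (Σ cᵢ bᵢ) restricted to S is injective on F₂^d, so d ≤ |S|.
-- * Embedding at j ∈ S. Pick v ∈ V with vⱼ = 1. Sample Y ~ P̃ and correct
--   every row i of Y by adding v whenever its j-th entry differs from qᵢ:
--   X = Y + (q + Yʲ) vᵀ, so Xʲ = q. The map Ψ(q, Y) = (Yʲ, X) is an involution
--   of F₂³ × F₂^{3×n} preserving the weight Q(q) P̃(Y): P̃ is invariant under
--   adding (even-parity column) ⊗ v, since such shifts keep every column's
--   parity and stay inside W = A + V³. Reindexing the sum by Ψ gives
--   Pr[X = M] = Σ_q Q(q) P̃(M) = P̃(M).

open import Defs
open import Algebra.Bundles using (CommutativeRing; CommutativeMonoid)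
open import Data.Bool using (Bool; true; false; _xor_; _∧_; if_then_else_; T)
open import Data.Bool.ListAction using (and)
open import Data.Bool.Properties
  using (xor-assoc; xor-comm; xor-identityˡ; xor-identityʳ; xor-same; ∧-zeroʳ; ∧-identityʳ;
         xor-∧-commutativeRing)
  renaming (_≟_ to _≟B_)
open import Data.Empty using (⊥-elim)
open import Data.Fin using (Fin; combine; quotient; remainder)
import Data.Fin as Fin
open import Data.Fin.Properties using (injective⇒≤; combine-injective; combine-remQuot)
open import Data.Fin.Subset using (Subset; _∈_; _⊆_; ∣_∣; ⋃)
open import Data.Fin.Subset.Properties using (p⊆p∪q; q⊆p∪q; x∈p∪q⁻; ∉⊥; drop-∷-⊆; ⊆-trans)
open import Data.Integer using () renaming (+_ to ℤ⁺)
open import Data.List using (List; []; _∷_; map; _++_; length; allFin; cartesianProductWith; cartesianProduct)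
import Data.List as List
import Data.List.Properties as ListP
open import Data.List.Membership.Propositional using (lose) renaming (_∈_ to _∈ₗ_)
open import Data.List.Membership.Propositional.Properties
  using (∈-map⁺; ∈-map⁻; ∈-allFin; ∈-cartesianProductWith⁺)
open import Data.List.Relation.Unary.Any using (here; there; satisfied)
open import Data.List.Relation.Unary.Any.Properties using (any⁺; any⁻)
open import Data.Nat using (ℕ; zero; suc; _≤_; _<_; _∸_; _^_)
import Data.Nat.Properties as ℕP
open import Data.Product using (Σ; _×_; _,_; proj₁; proj₂)
open import Data.Product.Properties using () renaming (≡-dec to ×-≡-dec)
open import Data.Rational
  using (ℚ; 0ℚ; 1ℚ; _+_; _*_; _÷_; _/_; 1/_; >-nonZero; positive; nonNegative)
  renaming (_≤_ to _≤ℚ_; _<_ to _<ℚ_)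
import Data.Rational.Properties as ℚP
open import Data.Sum using (inj₁; inj₂)
open import Data.Unit using (tt)
open import Data.Vec using (Vec; []; _∷_; lookup; zipWith)
import Data.Vec as Vec
import Data.Vec.Properties as VecP
open import Function using (_∘_)
open import Relation.Binary.Definitions using (DecidableEquality)
open import Relation.Binary.PropositionalEquality
open import Relation.Nullary using (yes; no; ¬_)
open import Relation.Nullary.Decidable using (⌊_⌋; toWitness; fromWitness)
open import Algebra.Properties.CommutativeSemigroup
  (CommutativeRing.+-commutativeSemigroup xor-∧-commutativeRing)
  using () renaming (interchange to xor-interchange; xy∙z≈xz∙y to xor-right-comm)
open import Algebra.Properties.CommutativeSemigroup
  (CommutativeMonoid.commutativeSemigroup ℚP.+-0-commutativeMonoid)
  using () renaming (interchange to +-interchange)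

sumL-cong : ∀ {A : Set} (xs : List A) {f g : A → ℚ} → (∀ x → f x ≡ g x) → sumL xs f ≡ sumL xs g
sumL-cong []       f≗g = refl
sumL-cong (x ∷ xs) f≗g = cong₂ _+_ (f≗g x) (sumL-cong xs f≗g)

sumL-++ : ∀ {A : Set} (xs ys : List A) (f : A → ℚ) → sumL (xs ++ ys) f ≡ sumL xs f + sumL ys f
sumL-++ []       ys f = sym (ℚP.+-identityˡ _)
sumL-++ (x ∷ xs) ys f = trans (cong (f x +_) (sumL-++ xs ys f)) (sym (ℚP.+-assoc (f x) _ _))

sumL-map : ∀ {A B : Set} (h : A → B) (xs : List A) (f : B → ℚ) → sumL (map h xs) f ≡ sumL xs (f ∘ h)
sumL-map h []       f = refl
sumL-map h (x ∷ xs) f = cong (f (h x) +_) (sumL-map h xs f)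

sumL-pairs : ∀ {A B C : Set} (pair : A → B → C) (xs : List A) (ys : List B) (f : C → ℚ) →
             sumL (cartesianProductWith pair xs ys) f ≡ sumL xs (λ x → sumL ys (λ y → f (pair x y)))
sumL-pairs pair []       ys f = refl
sumL-pairs pair (x ∷ xs) ys f =
  trans (sumL-++ (map (pair x) ys) _ f) (cong₂ _+_ (sumL-map (pair x) ys f) (sumL-pairs pair xs ys f))

sumL-zero : ∀ {A : Set} (xs : List A) → sumL xs (λ _ → 0ℚ) ≡ 0ℚ
sumL-zero []       = refl
sumL-zero (x ∷ xs) = trans (ℚP.+-identityˡ _) (sumL-zero xs)

sumL-+ : ∀ {A : Set} (xs : List A) (f g : A → ℚ) → sumL xs (λ x → f x + g x) ≡ sumL xs f + sumL xs g
sumL-+ []       f g = refl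
sumL-+ (x ∷ xs) f g = trans (cong ((f x + g x) +_) (sumL-+ xs f g)) (+-interchange (f x) (g x) _ _)

sumL-swap : ∀ {A B : Set} (xs : List A) (ys : List B) (f : A → B → ℚ) →
            sumL xs (λ x → sumL ys (f x)) ≡ sumL ys (λ y → sumL xs (λ x → f x y))
sumL-swap []       ys f = sym (sumL-zero ys)
sumL-swap (x ∷ xs) ys f = trans (cong (sumL ys (f x) +_) (sumL-swap xs ys f)) (sym (sumL-+ ys (f x) _))

sumL-*ʳ : ∀ {A : Set} (xs : List A) (f : A → ℚ) (c : ℚ) → sumL xs (λ x → f x * c) ≡ sumL xs f * c
sumL-*ʳ []       f c = sym (ℚP.*-zeroˡ c)
sumL-*ʳ (x ∷ xs) f c = trans (cong (f x * c +_) (sumL-*ʳ xs f c)) (sym (ℚP.*-distribʳ-+ c (f x) _))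

-- Summing over the positions of a list is summing over the list; this lets a
-- distribution on a finite list serve as a distribution on some Fin r.
sumFin-lookup : ∀ {A : Set} (xs : List A) (f : A → ℚ) → sumFin (length xs) (f ∘ List.lookup xs) ≡ sumL xs f
sumFin-lookup []       f = refl
sumFin-lookup (x ∷ xs) f = cong (f x +_) (begin
    sumL (List.tabulate Fin.suc) (f ∘ List.lookup (x ∷ xs))
      ≡⟨ cong (λ is → sumL is (f ∘ List.lookup (x ∷ xs))) (sym (ListP.map-tabulate (λ i → i) Fin.suc)) ⟩
    sumL (map Fin.suc (allFin (length xs))) (f ∘ List.lookup (x ∷ xs))
      ≡⟨ sumL-map Fin.suc (allFin (length xs)) _ ⟩
    sumFin (length xs) (f ∘ List.lookup xs)
      ≡⟨ sumFin-lookup xs f ⟩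
    sumL xs f ∎)
  where open ≡-Reasoning

*-vanishˡ : ∀ {a} b → a ≡ 0ℚ → a * b ≡ 0ℚ
*-vanishˡ b refl = ℚP.*-zeroˡ b

*-vanishʳ : ∀ a {b} → b ≡ 0ℚ → a * b ≡ 0ℚ
*-vanishʳ a refl = ℚP.*-zeroʳ a

productL : ∀ {A : Set} → (A → ℚ) → List A → ℚ
productL f = List.foldr (λ y acc → f y * acc) 1ℚ

productL-zero : ∀ {A : Set} (f : A → ℚ) (xs : List A) {x : A} → x ∈ₗ xs → f x ≡ 0ℚ → productL f xs ≡ 0ℚ
productL-zero f (x ∷ xs) (here refl) fx≡0 = *-vanishˡ (productL f xs) fx≡0
productL-zero f (y ∷ xs) (there x∈)  fx≡0 = *-vanishʳ (f y) (productL-zero f xs x∈ fx≡0)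

*-nonneg : ∀ {p q : ℚ} → 0ℚ ≤ℚ p → 0ℚ ≤ℚ q → 0ℚ ≤ℚ p * q
*-nonneg {p} {q} 0≤p 0≤q =
  ℚP.nonNegative⁻¹ (p * q) {{ℚP.nonNeg*nonNeg⇒nonNeg p {{nonNegative 0≤p}} q {{nonNegative 0≤q}}}}

productL-nonneg : ∀ {A : Set} (f : A → ℚ) (xs : List A) → (∀ x → 0ℚ ≤ℚ f x) → 0ℚ ≤ℚ productL f xs
productL-nonneg f []       f≥0 = toWitness {a? = 0ℚ ℚP.≤? 1ℚ} tt
productL-nonneg f (x ∷ xs) f≥0 = *-nonneg (f≥0 x) (productL-nonneg f xs f≥0)

δ : ∀ {A : Set} → DecidableEquality A → A → A → ℚ
δ _≟_ x y = indicator ⌊ x ≟ y ⌋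

δ-yes : ∀ {A : Set} (_≟_ : DecidableEquality A) {x y : A} → x ≡ y → δ _≟_ x y ≡ 1ℚ
δ-yes _≟_ {x} {y} x≡y with x ≟ y
... | yes _   = refl
... | no x≢y = ⊥-elim (x≢y x≡y)

δ-no : ∀ {A : Set} (_≟_ : DecidableEquality A) {x y : A} → ¬ x ≡ y → δ _≟_ x y ≡ 0ℚ
δ-no _≟_ {x} {y} x≢y with x ≟ y
... | yes x≡y = ⊥-elim (x≢y x≡y)
... | no _    = refl

δ-cong : ∀ {A B : Set} (_≟A_ : DecidableEquality A) (_≟B_ : DecidableEquality B) {x y : A} {x′ y′ : B} →
         (x ≡ y → x′ ≡ y′) → (x′ ≡ y′ → x ≡ y) → δ _≟A_ x y ≡ δ _≟B_ x′ y′
δ-cong _≟A_ _≟B_ {x} {y} to from with x ≟A y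
... | yes x≡y = sym (δ-yes _≟B_ (to x≡y))
... | no x≢y  = sym (δ-no _≟B_ (x≢y ∘ from))

δ-pair : ∀ {A B C : Set} (_≟A_ : DecidableEquality A) (_≟B_ : DecidableEquality B) (_≟C_ : DecidableEquality C)
         (pair : A → B → C) → (∀ {x y x′ y′} → pair x y ≡ pair x′ y′ → x ≡ x′ × y ≡ y′) →
         ∀ x y x′ y′ → δ _≟C_ (pair x y) (pair x′ y′) ≡ δ _≟A_ x x′ * δ _≟B_ y y′
δ-pair _≟A_ _≟B_ _≟C_ pair pair-injective x y x′ y′ with x ≟A x′ | y ≟B y′
... | yes x≡x′ | yes y≡y′ = δ-yes _≟C_ (cong₂ pair x≡x′ y≡y′)
... | yes _    | no y≢y′  = δ-no _≟C_ (y≢y′ ∘ proj₂ ∘ pair-injective)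
... | no x≢x′  | y≟y′     =
  trans (δ-no _≟C_ (x≢x′ ∘ proj₁ ∘ pair-injective)) (sym (ℚP.*-zeroˡ (indicator ⌊ y≟y′ ⌋)))

-- xs lists every element exactly once: summing against a point mass at z picks out z.
Enumerates : ∀ {A : Set} → DecidableEquality A → List A → Set
Enumerates {A} _≟_ xs = ∀ (g : A → ℚ) (z : A) → sumL xs (λ y → g y * δ _≟_ y z) ≡ g z

enumerates-pairs : ∀ {A B C : Set} {_≟A_ : DecidableEquality A} {_≟B_ : DecidableEquality B}
                   (_≟C_ : DecidableEquality C) (pair : A → B → C) →
                   (∀ {x y x′ y′} → pair x y ≡ pair x′ y′ → x ≡ x′ × y ≡ y′) →
                   {xs : List A} {ys : List B} → Enumerates _≟A_ xs → Enumerates _≟B_ ys →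
                   ∀ (g : C → ℚ) z₁ z₂ →
                   sumL (cartesianProductWith pair xs ys) (λ c → g c * δ _≟C_ c (pair z₁ z₂)) ≡ g (pair z₁ z₂)
enumerates-pairs {_≟A_ = _≟A_} {_≟B_} _≟C_ pair pair-injective {xs} {ys} enum-xs enum-ys g z₁ z₂ = begin
    sumL (cartesianProductWith pair xs ys) (λ c → g c * δ _≟C_ c (pair z₁ z₂))
      ≡⟨ sumL-pairs pair xs ys _ ⟩
    sumL xs (λ x → sumL ys (λ y → g (pair x y) * δ _≟C_ (pair x y) (pair z₁ z₂)))
      ≡⟨ sumL-cong xs (λ x → sumL-cong ys (λ y → factor x y)) ⟩
    sumL xs (λ x → sumL ys (λ y → (g (pair x y) * δ _≟A_ x z₁) * δ _≟B_ y z₂))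
      ≡⟨ sumL-cong xs (λ x → enum-ys (λ y → g (pair x y) * δ _≟A_ x z₁) z₂) ⟩
    sumL xs (λ x → g (pair x z₂) * δ _≟A_ x z₁)
      ≡⟨ enum-xs (λ x → g (pair x z₂)) z₁ ⟩
    g (pair z₁ z₂) ∎
  where
    open ≡-Reasoning
    factor : ∀ x y → g (pair x y) * δ _≟C_ (pair x y) (pair z₁ z₂)
                   ≡ (g (pair x y) * δ _≟A_ x z₁) * δ _≟B_ y z₂
    factor x y = trans (cong (g (pair x y) *_) (δ-pair _≟A_ _≟B_ _≟C_ pair pair-injective x y z₁ z₂))
                       (sym (ℚP.*-assoc (g (pair x y)) (δ _≟A_ x z₁) (δ _≟B_ y z₂)))

enumerates-Bool : Enumerates _≟B_ (false ∷ true ∷ [])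
enumerates-Bool g false = begin
    g false * 1ℚ + (g true * 0ℚ + 0ℚ)
      ≡⟨ cong₂ _+_ (ℚP.*-identityʳ (g false)) (trans (ℚP.+-identityʳ (g true * 0ℚ)) (ℚP.*-zeroʳ (g true))) ⟩
    g false + 0ℚ
      ≡⟨ ℚP.+-identityʳ (g false) ⟩
    g false ∎
  where open ≡-Reasoning
enumerates-Bool g true = begin
    g false * 0ℚ + (g true * 1ℚ + 0ℚ)
      ≡⟨ cong₂ _+_ (ℚP.*-zeroʳ (g false)) (trans (ℚP.+-identityʳ (g true * 1ℚ)) (ℚP.*-identityʳ (g true))) ⟩
    0ℚ + g true
      ≡⟨ ℚP.+-identityˡ (g true) ⟩
    g true ∎
  where open ≡-Reasoning

allVecOf-suc : ∀ {A : Set} (xs : List A) k →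
               allVecOf xs (suc k) ≡ cartesianProductWith (λ v x → x ∷ v) (allVecOf xs k) xs
allVecOf-suc xs k = go (allVecOf xs k)
  where
    go : ∀ vs → List.concatMap (λ v → map (λ x → x ∷ v) xs) vs ≡ cartesianProductWith (λ v x → x ∷ v) vs xs
    go []       = refl
    go (v ∷ vs) = cong (map (λ x → x ∷ v) xs ++_) (go vs)

enumerates-allVecOf : ∀ {A : Set} {_≟_ : DecidableEquality A} {xs : List A} →
                      Enumerates _≟_ xs → ∀ k → Enumerates (VecP.≡-dec _≟_) (allVecOf xs k)
enumerates-allVecOf enum zero    g []       = trans (ℚP.+-identityʳ _) (ℚP.*-identityʳ _)
enumerates-allVecOf {_≟_ = _≟_} {xs} enum (suc k) g (z ∷ zs) =
  trans (cong (λ vs → sumL vs (λ y → g y * δ (VecP.≡-dec _≟_) y (z ∷ zs))) (allVecOf-suc xs k))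
        (enumerates-pairs {_≟A_ = VecP.≡-dec _≟_} {_≟_} (VecP.≡-dec _≟_) (λ v x → x ∷ v)
          (λ eq → VecP.∷-injectiveʳ eq , VecP.∷-injectiveˡ eq)
          {allVecOf xs k} {xs} (enumerates-allVecOf enum k) enum g zs z)

enumerates-allVec : ∀ n → Enumerates (VecP.≡-dec _≟B_) (allVec n)
enumerates-allVec = enumerates-allVecOf enumerates-Bool

enumerates-allMat : ∀ k n → Enumerates _≟M_ (allMat k n)
enumerates-allMat k n = enumerates-allVecOf (enumerates-allVec n) k

enumerates-product : ∀ {A B : Set} {_≟A_ : DecidableEquality A} {_≟B_ : DecidableEquality B}
                     {xs : List A} {ys : List B} → Enumerates _≟A_ xs → Enumerates _≟B_ ys →
                     Enumerates (×-≡-dec _≟A_ _≟B_) (cartesianProduct xs ys)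
enumerates-product {_≟A_ = _≟A_} {_≟B_} {xs} {ys} enum-xs enum-ys g (z₁ , z₂) =
  enumerates-pairs {_≟A_ = _≟A_} {_≟B_} (×-≡-dec _≟A_ _≟B_) _,_ (λ { refl → refl , refl })
    {xs} {ys} enum-xs enum-ys g z₁ z₂

sum-involution : ∀ {A : Set} {_≟_ : DecidableEquality A} {xs : List A} → Enumerates _≟_ xs →
                 (Ψ : A → A) → (∀ a → Ψ (Ψ a) ≡ a) → ∀ (f : A → ℚ) → sumL xs (f ∘ Ψ) ≡ sumL xs f
sum-involution {_≟_ = _≟_} {xs} enum Ψ Ψ∘Ψ≡id f = begin
    sumL xs (λ a → f (Ψ a))
      ≡⟨ sumL-cong xs (λ a → sym (enum f (Ψ a))) ⟩
    sumL xs (λ a → sumL xs (λ b → f b * δ _≟_ b (Ψ a)))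
      ≡⟨ sumL-swap xs xs _ ⟩
    sumL xs (λ b → sumL xs (λ a → f b * δ _≟_ b (Ψ a)))
      ≡⟨ sumL-cong xs (λ b → sumL-cong xs (λ a → cong (f b *_) (mirror a b))) ⟩
    sumL xs (λ b → sumL xs (λ a → f b * δ _≟_ a (Ψ b)))
      ≡⟨ sumL-cong xs (λ b → enum (λ _ → f b) (Ψ b)) ⟩
    sumL xs f ∎
  where
    open ≡-Reasoning
    mirror : ∀ a b → δ _≟_ b (Ψ a) ≡ δ _≟_ a (Ψ b)
    mirror a b = δ-cong _≟_ _≟_ (λ b≡Ψa → trans (sym (Ψ∘Ψ≡id a)) (cong Ψ (sym b≡Ψa)))
                                (λ a≡Ψb → trans (sym (Ψ∘Ψ≡id b)) (cong Ψ (sym a≡Ψb)))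

⊕-assoc : ∀ {n} (x y z : Vec Bool n) → (x ⊕ y) ⊕ z ≡ x ⊕ (y ⊕ z)
⊕-assoc = VecP.zipWith-assoc xor-assoc

⊕-comm : ∀ {n} (x y : Vec Bool n) → x ⊕ y ≡ y ⊕ x
⊕-comm = VecP.zipWith-comm xor-comm

⊕-identityˡ : ∀ {n} (x : Vec Bool n) → 𝟎 ⊕ x ≡ x
⊕-identityˡ = VecP.zipWith-identityˡ xor-identityˡ

⊕-identityʳ : ∀ {n} (x : Vec Bool n) → x ⊕ 𝟎 ≡ x
⊕-identityʳ = VecP.zipWith-identityʳ xor-identityʳ

⊕-self : ∀ {n} (x : Vec Bool n) → x ⊕ x ≡ 𝟎
⊕-self []      = refl
⊕-self (a ∷ x) = cong₂ _∷_ (xor-same a) (⊕-self x)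

⊕-interchange : ∀ {n} (w x y z : Vec Bool n) → (w ⊕ x) ⊕ (y ⊕ z) ≡ (w ⊕ y) ⊕ (x ⊕ z)
⊕-interchange []      []      []      []      = refl
⊕-interchange (a ∷ w) (b ∷ x) (c ∷ y) (d ∷ z) = cong₂ _∷_ (xor-interchange a b c d) (⊕-interchange w x y z)

⊕-right-comm : ∀ {n} (x y z : Vec Bool n) → (x ⊕ y) ⊕ z ≡ (x ⊕ z) ⊕ y
⊕-right-comm []      []      []      = refl
⊕-right-comm (a ∷ x) (b ∷ y) (c ∷ z) = cong₂ _∷_ (xor-right-comm a b c) (⊕-right-comm x y z)

⊕-cancelʳ : ∀ {n} (x y : Vec Bool n) → (x ⊕ y) ⊕ y ≡ x
⊕-cancelʳ x y = trans (⊕-assoc x y y) (trans (cong (x ⊕_) (⊕-self y)) (⊕-identityʳ x))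

⊕-cancelˡ : ∀ {n} (x y : Vec Bool n) → x ⊕ (y ⊕ x) ≡ y
⊕-cancelˡ x y = trans (⊕-comm x (y ⊕ x)) (⊕-cancelʳ y x)

⊕≡𝟎⇒≡ : ∀ {n} {x y : Vec Bool n} → x ⊕ y ≡ 𝟎 → x ≡ y
⊕≡𝟎⇒≡ {x = x} {y} x⊕y≡𝟎 = trans (sym (⊕-cancelʳ x y)) (trans (cong (_⊕ y) x⊕y≡𝟎) (⊕-identityˡ y))

scale : ∀ {n} → Bool → Vec Bool n → Vec Bool n
scale c v = if c then v else 𝟎

scale-xor : ∀ {n} a c (v : Vec Bool n) → scale (a xor c) v ≡ scale a v ⊕ scale c v
scale-xor false false v = sym (⊕-identityˡ 𝟎)
scale-xor false true  v = sym (⊕-identityˡ v)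
scale-xor true  false v = sym (⊕-identityʳ v)
scale-xor true  true  v = sym (⊕-self v)

lookup-scale : ∀ {n} c (v : Vec Bool n) l → lookup (scale c v) l ≡ lookup v l ∧ c
lookup-scale false v l = trans (VecP.lookup-replicate l false) (sym (∧-zeroʳ (lookup v l)))
lookup-scale true  v l = sym (∧-identityʳ (lookup v l))

lincomb-⊕ : ∀ {d n} (c c′ : Vec Bool d) (b : Vec (Vec Bool n) d) →
            lincomb (c ⊕ c′) b ≡ lincomb c b ⊕ lincomb c′ b
lincomb-⊕ []      []        []      = sym (⊕-identityˡ 𝟎)
lincomb-⊕ (a ∷ c) (a′ ∷ c′) (x ∷ b) =
  trans (cong₂ _⊕_ (scale-xor a a′ x) (lincomb-⊕ c c′ b)) (⊕-interchange (scale a x) (scale a′ x) _ _)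

lincomb-injective : ∀ {d n} (b : Vec (Vec Bool n) d) → LinIndep b →
                    ∀ {c c′} → lincomb c b ≡ lincomb c′ b → c ≡ c′
lincomb-injective b independent {c} {c′} same =
  ⊕≡𝟎⇒≡ (independent (c ⊕ c′) (trans (lincomb-⊕ c c′ b) (trans (cong (_⊕ lincomb c′ b) same) (⊕-self _))))

Spanned : ∀ {d n} → Vec (Vec Bool n) d → Vec Bool n → Set
Spanned {d} b w = Σ (Vec Bool d) λ c → lincomb c b ≡ w

spanned-⊕ : ∀ {d n} (b : Vec (Vec Bool n) d) {u w} → Spanned b u → Spanned b w → Spanned b (u ⊕ w)
spanned-⊕ b (c , refl) (c′ , refl) = c ⊕ c′ , lincomb-⊕ c c′ b

allVec-complete : ∀ {n} (v : Vec Bool n) → v ∈ₗ allVec n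
allVec-complete []      = here refl
allVec-complete (a ∷ v) = subst (a ∷ v ∈ₗ_) (sym (allVecOf-suc _ _))
  (∈-cartesianProductWith⁺ (λ w x → x ∷ w) (allVec-complete v) (bit∈ a))
  where
    bit∈ : ∀ a → a ∈ₗ (false ∷ true ∷ [])
    bit∈ false = here refl
    bit∈ true  = there (here refl)

inSpan-sound : ∀ {d n} (b : Vec (Vec Bool n) d) {w} → T (inSpan b w) → Spanned b w
inSpan-sound {d} b t with satisfied (any⁻ _ (allVec d) t)
... | c , found = c , toWitness found

inSpan-complete : ∀ {d n} (b : Vec (Vec Bool n) d) {w} → Spanned b w → T (inSpan b w)
inSpan-complete b (c , eq) = any⁺ _ (lose (allVec-complete c) (fromWitness eq))

T-ext : ∀ {x y : Bool} → (T x → T y) → (T y → T x) → x ≡ y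
T-ext {false} {false} _  _  = refl
T-ext {false} {true}  _  y⇒x = ⊥-elim (y⇒x tt)
T-ext {true}  {false} x⇒y _  = ⊥-elim (x⇒y tt)
T-ext {true}  {true}  _  _  = refl

inSpan-translate : ∀ {d n} (b : Vec (Vec Bool n) d) {u} → Spanned b u → ∀ w → inSpan b (w ⊕ u) ≡ inSpan b w
inSpan-translate b {u} u∈V w = T-ext
  (λ t → inSpan-complete b (subst (Spanned b) (⊕-cancelʳ w u) (spanned-⊕ b (inSpan-sound b t) u∈V)))
  (λ t → inSpan-complete b (spanned-⊕ b (inSpan-sound b t) u∈V))

support : ∀ {d n} → Vec (Vec Bool n) d → Subset n
support {d} b = ⋃ (map (λ c → lincomb c b) (allVec d))

⊆-⋃ : ∀ {n} {p : Subset n} {ps : List (Subset n)} → p ∈ₗ ps → p ⊆ ⋃ ps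
⊆-⋃ {ps = q ∷ qs} (here refl) = p⊆p∪q (⋃ qs)
⊆-⋃ {ps = q ∷ qs} (there p∈)  = ⊆-trans (⊆-⋃ p∈) (q⊆p∪q q (⋃ qs))

∈-⋃⁻ : ∀ {n} {x : Fin n} (ps : List (Subset n)) → x ∈ ⋃ ps → Σ (Subset n) λ p → p ∈ₗ ps × x ∈ p
∈-⋃⁻ []       x∈⊥ = ⊥-elim (∉⊥ x∈⊥)
∈-⋃⁻ (p ∷ ps) x∈  with x∈p∪q⁻ p (⋃ ps) x∈
... | inj₁ x∈p = p , here refl , x∈p
... | inj₂ x∈⋃ with ∈-⋃⁻ ps x∈⋃
...   | q , q∈ , x∈q = q , there q∈ , x∈q

support-contains : ∀ {d n} (b : Vec (Vec Bool n) d) c → lincomb c b ⊆ support b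
support-contains b c = ⊆-⋃ (∈-map⁺ (λ c′ → lincomb c′ b) (allVec-complete c))

support-witness : ∀ {d n} (b : Vec (Vec Bool n) d) {j} → j ∈ support b → Σ (Vec Bool d) λ c → j ∈ lincomb c b
support-witness {d} b j∈S with ∈-⋃⁻ (map (λ c → lincomb c b) (allVec d)) j∈S
... | p , p∈ , j∈p with ∈-map⁻ (λ c → lincomb c b) p∈
...   | c , _ , refl = c , j∈p

restrict : ∀ {n} (s : Subset n) → Vec Bool n → Vec Bool ∣ s ∣
restrict []          []      = []
restrict (false ∷ s) (_ ∷ x) = restrict s x
restrict (true  ∷ s) (a ∷ x) = a ∷ restrict s x

outside-head : ∀ {n} {a} {x : Vec Bool n} {s} → (a ∷ x) ⊆ (false ∷ s) → a ≡ false
outside-head {a = false} _  = refl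
outside-head {a = true}  ⊆s with ⊆s Vec.here
... | ()

restrict-injective : ∀ {n} (s : Subset n) {x y : Vec Bool n} → x ⊆ s → y ⊆ s → restrict s x ≡ restrict s y → x ≡ y
restrict-injective []          {[]}    {[]}    _   _   _  = refl
restrict-injective (false ∷ s) {a ∷ x} {a′ ∷ y} x⊆s y⊆s eq =
  cong₂ _∷_ (trans (outside-head x⊆s) (sym (outside-head y⊆s)))
            (restrict-injective s (drop-∷-⊆ x⊆s) (drop-∷-⊆ y⊆s) eq)
restrict-injective (true ∷ s)  {a ∷ x} {a′ ∷ y} x⊆s y⊆s eq =
  cong₂ _∷_ (VecP.∷-injectiveˡ eq) (restrict-injective s (drop-∷-⊆ x⊆s) (drop-∷-⊆ y⊆s) (VecP.∷-injectiveʳ eq))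

bit : Bool → Fin 2
bit false = Fin.zero
bit true  = Fin.suc Fin.zero

unbit : Fin 2 → Bool
unbit Fin.zero       = false
unbit (Fin.suc Fin.zero) = true

bit-unbit : ∀ i → bit (unbit i) ≡ i
bit-unbit Fin.zero           = refl
bit-unbit (Fin.suc Fin.zero) = refl

bit-injective : ∀ {a a′} → bit a ≡ bit a′ → a ≡ a′
bit-injective {false} {false} _ = refl
bit-injective {true}  {true}  _ = refl

encode : ∀ {k} → Vec Bool k → Fin (2 ^ k)
encode []      = Fin.zero
encode (a ∷ x) = combine (bit a) (encode x)

decode : ∀ k → Fin (2 ^ k) → Vec Bool k
decode zero    _ = []
decode (suc k) i = unbit (quotient {2} (2 ^ k) i) ∷ decode k (remainder {2} (2 ^ k) i)

encode-decode : ∀ k (i : Fin (2 ^ k)) → encode (decode k i) ≡ i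
encode-decode zero    Fin.zero = refl
encode-decode (suc k) i =
  trans (cong₂ combine (bit-unbit (quotient {2} (2 ^ k) i)) (encode-decode k (remainder {2} (2 ^ k) i)))
        (combine-remQuot {n = 2} (2 ^ k) i)

encode-injective : ∀ {k} {x y : Vec Bool k} → encode x ≡ encode y → x ≡ y
encode-injective {x = []}    {[]}     _  = refl
encode-injective {x = a ∷ x} {a′ ∷ y} eq with combine-injective (bit a) (encode x) (bit a′) (encode y) eq
... | same-bit , same-rest = cong₂ _∷_ (bit-injective same-bit) (encode-injective same-rest)

-- An injection F₂^m → F₂^n forces m ≤ n (pigeonhole on 2^m ≤ 2^n).
bitvector-injection-≤ : ∀ {m n} (f : Vec Bool m → Vec Bool n) → (∀ {x y} → f x ≡ f y → x ≡ y) → m ≤ n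
bitvector-injection-≤ {m} {n} f f-injective =
  ℕP.≮⇒≥ (λ n<m → ℕP.<⇒≱ (ℕP.^-monoʳ-< 2 (ℕP.n<1+n 1) n<m) powers)
  where
    decode-injective : ∀ {i j} → decode m i ≡ decode m j → i ≡ j
    decode-injective {i} {j} eq =
      trans (sym (encode-decode m i)) (trans (cong encode eq) (encode-decode m j))
    powers : 2 ^ m ≤ 2 ^ n
    powers = injective⇒≤ {f = encode ∘ f ∘ decode m} (decode-injective ∘ f-injective ∘ encode-injective)

-- dim V ≤ |support V|: restricting V to its support is injective.
dim≤∣support∣ : ∀ {d n} (b : Vec (Vec Bool n) d) → LinIndep b → d ≤ ∣ support b ∣
dim≤∣support∣ b independent = bitvector-injection-≤ (λ c → restrict (support b) (lincomb c b))
  (λ {c} {c′} eq → lincomb-injective b independent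
     (restrict-injective (support b) (support-contains b c) (support-contains b c′) eq))

parity : Vec Bool 3 → Bool
parity (x₁ ∷ x₂ ∷ x₃ ∷ []) = x₁ xor x₂ xor x₃

parity-⊕ : ∀ x y → parity (x ⊕ y) ≡ parity x xor parity y
parity-⊕ (a ∷ b ∷ c ∷ []) (a′ ∷ b′ ∷ c′ ∷ []) =
  trans (cong ((a xor a′) xor_) (xor-interchange b b′ c c′)) (xor-interchange a a′ (b xor c) (b′ xor c′))

ghzWeight : Bool → ℚ
ghzWeight odd = if odd then 0ℚ else ℤ⁺ 1 / 4

GHZ-parity : ∀ x → GHZ x ≡ ghzWeight (parity x)
GHZ-parity (x₁ ∷ x₂ ∷ x₃ ∷ []) = refl

GHZ-odd : ∀ x → parity x ≡ true → GHZ x ≡ 0ℚ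
GHZ-odd x odd = trans (GHZ-parity x) (cong ghzWeight odd)

GHZ-even : ∀ x y → parity x ≡ false → parity y ≡ false → GHZ x ≡ GHZ y
GHZ-even x y x-even y-even = trans (GHZ-parity x) (trans (cong ghzWeight (trans x-even (sym y-even))) (sym (GHZ-parity y)))

GHZ-translate : ∀ x d → parity d ≡ false → GHZ (x ⊕ d) ≡ GHZ x
GHZ-translate x d d-even = trans (GHZ-parity (x ⊕ d)) (trans (cong ghzWeight parity-same) (sym (GHZ-parity x)))
  where
    parity-same : parity (x ⊕ d) ≡ parity x
    parity-same = trans (parity-⊕ x d) (trans (cong (parity x xor_) d-even) (xor-identityʳ (parity x)))

GHZ-nonneg : ∀ x → 0ℚ ≤ℚ GHZ x
GHZ-nonneg x = subst (0ℚ ≤ℚ_) (sym (GHZ-parity x)) (weight-nonneg (parity x))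
  where
    weight-nonneg : ∀ odd → 0ℚ ≤ℚ ghzWeight odd
    weight-nonneg true  = ℚP.≤-refl
    weight-nonneg false = toWitness {a? = 0ℚ ℚP.≤? (ℤ⁺ 1 / 4)} tt

GHZ-total : sumL (allVec 3) GHZ ≡ 1ℚ
GHZ-total = refl

-- shift v d Y adds v to the rows i of Y with dᵢ = 1, i.e. Y ↦ Y + d vᵀ.
shift : ∀ {k n} → Vec Bool n → Vec Bool k → Mat k n → Mat k n
shift v d Y = zipWith (λ dᵢ yᵢ → yᵢ ⊕ scale dᵢ v) d Y

shift-involutive : ∀ {k n} (v : Vec Bool n) (d : Vec Bool k) (Y : Mat k n) → shift v d (shift v d Y) ≡ Y
shift-involutive v []       []      = refl
shift-involutive v (dᵢ ∷ d) (y ∷ Y) = cong₂ _∷_ (⊕-cancelʳ y (scale dᵢ v)) (shift-involutive v d Y)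

column-shift : ∀ {k n} (v : Vec Bool n) l (d : Vec Bool k) (Y : Mat k n) →
               column l (shift v d Y) ≡ column l Y ⊕ Vec.map (lookup v l ∧_) d
column-shift v l []       []      = refl
column-shift v l (dᵢ ∷ d) (y ∷ Y) =
  cong₂ _∷_ (trans (VecP.lookup-zipWith _xor_ l y (scale dᵢ v)) (cong (lookup y l xor_) (lookup-scale dᵢ v l)))
            (column-shift v l d Y)

column-shift-hit : ∀ {k n} (v : Vec Bool n) j → lookup v j ≡ true → (d : Vec Bool k) (Y : Mat k n) →
                   column j (shift v d Y) ≡ column j Y ⊕ d
column-shift-hit v j vⱼ d Y =
  trans (column-shift v j d Y)
        (trans (cong (λ c → column j Y ⊕ Vec.map (c ∧_) d) vⱼ) (cong (column j Y ⊕_) (VecP.map-id d)))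

mask-even : ∀ c d → parity d ≡ false → parity (Vec.map (c ∧_) d) ≡ false
mask-even false (_ ∷ _ ∷ _ ∷ []) _      = refl
mask-even true  (_ ∷ _ ∷ _ ∷ []) d-even = d-even

Qpow-shift : ∀ {n} (v : Vec Bool n) d (M : Mat 3 n) → parity d ≡ false → Qpow n (shift v d M) ≡ Qpow n M
Qpow-shift {n} v d M d-even = ListP.foldr-cong (λ l acc → cong (_* acc) (column-weight l)) refl (allFin n)
  where
    column-weight : ∀ l → GHZ (column l (shift v d M)) ≡ GHZ (column l M)
    column-weight l = trans (cong GHZ (column-shift v l d M))
                            (GHZ-translate (column l M) _ (mask-even (lookup v l) d d-even))

Qpow-odd : ∀ {n} (M : Mat 3 n) l → parity (column l M) ≡ true → Qpow n M ≡ 0ℚ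
Qpow-odd {n} M l odd = productL-zero (λ l′ → GHZ (column l′ M)) (allFin n) (∈-allFin l) (GHZ-odd (column l M) odd)

inAffine-shift : ∀ {d n} (b : Vec (Vec Bool n) d) (A : Mat 3 n) {v} → Spanned b v →
                 ∀ e (M : Mat 3 n) → inAffine b A (shift v e M) ≡ inAffine b A M
inAffine-shift b A {v} v∈V e M = cong and (ListP.map-cong row (allFin 3))
  where
    translate : ∀ c w → inSpan b (w ⊕ scale c v) ≡ inSpan b w
    translate false w = cong (inSpan b) (⊕-identityʳ w)
    translate true  w = inSpan-translate b v∈V w
    row : ∀ i → inSpan b (lookup (shift v e M) i ⊕ lookup A i) ≡ inSpan b (lookup M i ⊕ lookup A i)
    row i = begin
        inSpan b (lookup (shift v e M) i ⊕ lookup A i)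
          ≡⟨ cong (λ r → inSpan b (r ⊕ lookup A i)) (VecP.lookup-zipWith _ i e M) ⟩
        inSpan b ((lookup M i ⊕ scale (lookup e i) v) ⊕ lookup A i)
          ≡⟨ cong (inSpan b) (⊕-right-comm (lookup M i) _ _) ⟩
        inSpan b ((lookup M i ⊕ lookup A i) ⊕ scale (lookup e i) v)
          ≡⟨ translate (lookup e i) _ ⟩
        inSpan b (lookup M i ⊕ lookup A i) ∎
      where open ≡-Reasoning

module Conditioned {d n} (b : Vec (Vec Bool n) d) (A : Mat 3 n) (pos : 0ℚ <ℚ QpowW n b A) where

  P̃ : Mat 3 n → ℚ
  P̃ = Qcond n b A pos

  P̃-shift : ∀ {v} → Spanned b v → ∀ e M → parity e ≡ false → P̃ (shift v e M) ≡ P̃ M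
  P̃-shift {v} v∈V e M e-even = cong (λ t → (t ÷ QpowW n b A) {{>-nonZero pos}})
    (cong₂ _*_ (Qpow-shift v e M e-even) (cong indicator (inAffine-shift b A v∈V e M)))

  P̃-odd : ∀ M l → parity (column l M) ≡ true → P̃ M ≡ 0ℚ
  P̃-odd M l odd = begin
      (Qpow n M * indicator (inAffine b A M) ÷ QpowW n b A) {{>-nonZero pos}}
        ≡⟨ cong (λ t → (t * indicator (inAffine b A M) ÷ QpowW n b A) {{>-nonZero pos}}) (Qpow-odd M l odd) ⟩
      (0ℚ * indicator (inAffine b A M) ÷ QpowW n b A) {{>-nonZero pos}}
        ≡⟨ cong (λ t → (t ÷ QpowW n b A) {{>-nonZero pos}}) (ℚP.*-zeroˡ (indicator (inAffine b A M))) ⟩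
      (0ℚ ÷ QpowW n b A) {{>-nonZero pos}}
        ≡⟨ ℚP.*-zeroˡ ((1/ QpowW n b A) {{>-nonZero pos}}) ⟩
      0ℚ ∎
    where open ≡-Reasoning

  P̃-nonneg : ∀ M → 0ℚ ≤ℚ P̃ M
  P̃-nonneg M =
    *-nonneg (*-nonneg (productL-nonneg _ (allFin n) (λ l → GHZ-nonneg (column l M))) (indicator-nonneg (inAffine b A M)))
    (ℚP.<⇒≤ (ℚP.positive⁻¹ _ {{ℚP.1/pos⇒pos (QpowW n b A) {{positive pos}}}}))
    where
      indicator-nonneg : ∀ t → 0ℚ ≤ℚ indicator t
      indicator-nonneg true  = toWitness {a? = 0ℚ ℚP.≤? 1ℚ} tt
      indicator-nonneg false = ℚP.≤-refl

  P̃-total : sumL (allMat 3 n) P̃ ≡ 1ℚ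
  P̃-total = trans (sumL-*ʳ (allMat 3 n) (λ M → Qpow n M * indicator (inAffine b A M)) _)
                  (ℚP.*-inverseʳ (QpowW n b A) {{>-nonZero pos}})

module LocalEmbedding {d n} (b : Vec (Vec Bool n) d) (A : Mat 3 n) (pos : 0ℚ <ℚ QpowW n b A)
                      (j : Fin n) {v : Vec Bool n} (v∈V : Spanned b v) (vⱼ : lookup v j ≡ true) where

  open Conditioned b A pos

  embed : Vec Bool 3 → Mat 3 n → Mat 3 n
  embed q Y = shift v (q ⊕ column j Y) Y

  column-embed : ∀ q Y → column j (embed q Y) ≡ q
  column-embed q Y = trans (column-shift-hit v j vⱼ (q ⊕ column j Y) Y) (⊕-cancelˡ (column j Y) q)

  Ψ : Vec Bool 3 × Mat 3 n → Vec Bool 3 × Mat 3 n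
  Ψ (q , Y) = column j Y , embed q Y

  Ψ-involutive : ∀ p → Ψ (Ψ p) ≡ p
  Ψ-involutive (q , Y) = cong₂ _,_ (column-embed q Y) (begin
      shift v (column j Y ⊕ column j (embed q Y)) (embed q Y)
        ≡⟨ cong (λ c → shift v (column j Y ⊕ c) (embed q Y)) (column-embed q Y) ⟩
      shift v (column j Y ⊕ q) (embed q Y)
        ≡⟨ cong (λ e → shift v e (embed q Y)) (⊕-comm (column j Y) q) ⟩
      shift v (q ⊕ column j Y) (shift v (q ⊕ column j Y) Y)
        ≡⟨ shift-involutive v (q ⊕ column j Y) Y ⟩
      Y ∎)
    where open ≡-Reasoning

  weight : Vec Bool 3 × Mat 3 n → ℚ
  weight (q , Y) = GHZ q * P̃ Y

  -- Ψ preserves the joint law: both sides vanish unless q and Yʲ are even,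
  -- and then Q(Yʲ) = Q(q) while P̃ is invariant under the even shift q + Yʲ.
  weight-Ψ : ∀ p → weight (Ψ p) ≡ weight p
  weight-Ψ (q , Y) with parity q in q-parity | parity (column j Y) in Yʲ-parity
  ... | true  | _     = trans (*-vanishʳ (GHZ (column j Y)) (P̃-odd (embed q Y) j embed-odd))
                              (sym (*-vanishˡ (P̃ Y) (GHZ-odd q q-parity)))
    where embed-odd = trans (cong parity (column-embed q Y)) q-parity
  ... | false | true  = trans (*-vanishˡ (P̃ (embed q Y)) (GHZ-odd (column j Y) Yʲ-parity))
                              (sym (*-vanishʳ (GHZ q) (P̃-odd Y j Yʲ-parity)))
  ... | false | false = cong₂ _*_ (GHZ-even (column j Y) q Yʲ-parity q-parity)
                                 (P̃-shift v∈V (q ⊕ column j Y) Y shift-even)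
    where shift-even = trans (parity-⊕ q (column j Y)) (cong₂ _xor_ q-parity Yʲ-parity)

  -- The randomness is a sample Y ~ P̃, indexed by its position in allMat.
  mats : List (Mat 3 n)
  mats = allMat 3 n

  R : Fin (length mats) → ℚ
  R ρ = P̃ (List.lookup mats ρ)

  e : Fin 3 → Bool → Fin (length mats) → Vec Bool n
  e i x ρ = yᵢ ⊕ scale (x xor lookup yᵢ j) v
    where yᵢ = lookup (List.lookup mats ρ) i

  embMat-embed : ∀ q ρ → embMat e q ρ ≡ embed q (List.lookup mats ρ)
  embMat-embed (_ ∷ _ ∷ _ ∷ []) ρ with List.lookup mats ρ
  ... | _ ∷ _ ∷ _ ∷ [] = refl

  -- Law of X = embed q Y: reindex the joint sum by the weight-preserving involution Ψ.
  law : ∀ M → sumL (allVec 3) (λ q → sumFin (length mats) (λ ρ → GHZ q * R ρ * δ _≟M_ (embMat e q ρ) M))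
              ≡ P̃ M
  law M = begin
      sumL (allVec 3) (λ q → sumFin (length mats) (λ ρ → GHZ q * R ρ * δ _≟M_ (embMat e q ρ) M))
        ≡⟨ sumL-cong (allVec 3) reindex ⟩
      sumL (allVec 3) (λ q → sumL mats (λ Y → weight (q , Y) * δ _≟M_ (proj₂ (Ψ (q , Y))) M))
        ≡⟨ sym (sumL-pairs _,_ (allVec 3) mats _) ⟩
      sumL pairs (λ p → weight p * δ _≟M_ (proj₂ (Ψ p)) M)
        ≡⟨ sumL-cong pairs (λ p → cong (_* δ _≟M_ (proj₂ (Ψ p)) M) (sym (weight-Ψ p))) ⟩
      sumL pairs (λ p → weight (Ψ p) * δ _≟M_ (proj₂ (Ψ p)) M)
        ≡⟨ sum-involution {_≟_ = ×-≡-dec (VecP.≡-dec _≟B_) _≟M_} {pairs} enumerates-queries×mats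
                          Ψ Ψ-involutive (λ p → weight p * δ _≟M_ (proj₂ p) M) ⟩
      sumL pairs (λ p → weight p * δ _≟M_ (proj₂ p) M)
        ≡⟨ sumL-pairs _,_ (allVec 3) mats _ ⟩
      sumL (allVec 3) (λ q → sumL mats (λ Y → GHZ q * P̃ Y * δ _≟M_ Y M))
        ≡⟨ sumL-cong (allVec 3) (λ q → enumerates-allMat 3 n (λ Y → GHZ q * P̃ Y) M) ⟩
      sumL (allVec 3) (λ q → GHZ q * P̃ M)
        ≡⟨ sumL-*ʳ (allVec 3) GHZ (P̃ M) ⟩
      sumL (allVec 3) GHZ * P̃ M
        ≡⟨ cong (_* P̃ M) GHZ-total ⟩
      1ℚ * P̃ M
        ≡⟨ ℚP.*-identityˡ (P̃ M) ⟩
      P̃ M ∎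
    where
      open ≡-Reasoning
      pairs = cartesianProduct (allVec 3) mats
      enumerates-queries×mats : Enumerates (×-≡-dec (VecP.≡-dec _≟B_) _≟M_) pairs
      enumerates-queries×mats = enumerates-product {_≟A_ = VecP.≡-dec _≟B_} {_≟M_} {allVec 3} {mats}
                                            (enumerates-allVec 3) (enumerates-allMat 3 n)
      reindex : ∀ q → sumFin (length mats) (λ ρ → GHZ q * R ρ * δ _≟M_ (embMat e q ρ) M)
                    ≡ sumL mats (λ Y → GHZ q * P̃ Y * δ _≟M_ (embed q Y) M)
      reindex q = trans (sumL-cong (allFin (length mats))
                               (λ ρ → cong (λ X → GHZ q * R ρ * δ _≟M_ X M) (embMat-embed q ρ)))
                        (sumFin-lookup mats (λ Y → GHZ q * P̃ Y * δ _≟M_ (embed q Y) M))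

  embeddable : LocallyEmbeddable GHZ P̃ j
  embeddable =
    length mats , R , (λ ρ → P̃-nonneg (List.lookup mats ρ)) , trans (sumFin-lookup mats P̃) P̃-total ,
    e , law , (λ q ρ _ → trans (cong (column j) (embMat-embed q ρ)) (column-embed q (List.lookup mats ρ)))

proposition5p2 : (n m : ℕ) → 1 ≤ m → m < n →
    (b : Vec (Vec Bool n) (n ∸ m)) → LinIndep b →
    (A : Mat 3 n) → (pos : 0ℚ <ℚ QpowW n b A) →
    Σ (Subset n) λ S → (n ∸ m ≤ ∣ S ∣) ×
      (∀ j → j ∈ S → LocallyEmbeddable GHZ (Qcond n b A pos) j)
proposition5p2 n m _ _ b independent A pos = support b , dim≤∣support∣ b independent , embeddable-at
  where
    embeddable-at : ∀ j → j ∈ support b → LocallyEmbeddable GHZ (Qcond n b A pos) j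
    embeddable-at j j∈S with support-witness b j∈S
    ... | c , j∈v = LocalEmbedding.embeddable b A pos j (c , refl) (VecP.[]=⇒lookup j∈v)
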